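{- Let $B=[b_{ij}]$ be an $r\times n$ integer matrix and $c=(c_1,\dots,c_r)$ an integer vector, and let $\mathcal S$ be the Diophantine system $Bp=c$ in nonnegative integer unknowns $p=(p_1,\dots,p_n)$, with complete generating function $F_{\mathcal S}(x_1,\dots,x_n)=\sum_{p\in\mathcal S}x_1^{p_1}\cdots x_n^{p_n}$ (sum over nonnegative integer solutions). Let $\mathcal{SS}$ be the system in nonnegative integer unknowns $p=(p_1,\dots,p_{2n})$ given by $[B\,|\,B]\,p=c'$, where $[B\,|\,B]$ is the $r\times 2n$ matrix obtained by placing two copies of $B$ side by side and $c'_i=c_i-b_{i1}-b_{i2}-\cdots-b_{in}$ for $i=1,\dots,r$. Then the complete generating function of $\mathcal{SS}$ is $$F_{\mathcal{SS}}(x_1,\dots,x_{2n})=\delta_{1,n+1}\delta_{2,n+2}\cdots\delta_{n,2n}F_{\mathcal S}(x_1,\dots,x_n).$$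
   Context: For indices $i\ne j$, the divided difference operator $\delta_{i,j}$ acts on a function $f(x)$ by $\delta_{i,j}f(x)=\dfrac{f(x)-f(x)|_{x_i\leftrightarrow x_j}}{x_i-x_j}$, where $f(x)|_{x_i\leftrightarrow x_j}$ denotes $f$ with the variables $x_i$ and $x_j$ interchanged. -}

module Defs where

open import Data.Nat using (ℕ; zero; suc; pred)
open import Data.Integer using (ℤ; +_; _+_; _-_; _*_; 0ℤ; 1ℤ)
import Data.Integer.Properties as ℤP
open import Data.Fin using (Fin; zero; suc; _↑ˡ_; _↑ʳ_; splitAt; inject₁; fromℕ)
open import Data.Fin.Properties using (all?)
open import Data.Fin.Permutation.Components using (transpose)
open import Data.Vec.Functional using (updateAt)
open import Data.Sum using ([_,_])
open import Data.Bool using (if_then_else_)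
open import Relation.Nullary using (does)
open import Relation.Binary.PropositionalEquality using (_≡_)

Mon : ℕ → Set
Mon m = Fin m → ℕ

Series : ℕ → Set
Series m = Mon m → ℤ

_≋_ : ∀ {m} → Series m → Series m → Set
F ≋ G = ∀ p → F p ≡ G p

∑ : ∀ {n} → (Fin n → ℤ) → ℤ
∑ {zero}  f = 0ℤ
∑ {suc n} f = f zero + ∑ (λ j → f (suc j))

Matrix : ℕ → ℕ → Set
Matrix r n = Fin r → Fin n → ℤ

IsSolution : ∀ {r n} → Matrix r n → (Fin r → ℤ) → Mon n → Set
IsSolution B c p = ∀ i → ∑ (λ j → B i j * + (p j)) ≡ c i

genFun : ∀ {r n} → Matrix r n → (Fin r → ℤ) → Series n
genFun B c p =
  if does (all? (λ i → ∑ (λ j → B i j * + (p j)) ℤP.≟ c i)) then 1ℤ else 0ℤ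

mulVar : ∀ {m} → Fin m → Series m → Series m
mulVar i G p with p i
... | zero  = 0ℤ
... | suc _ = G (updateAt p i pred)

swapVars : ∀ {m} → Fin m → Fin m → Series m → Series m
swapVars i j F p = F (λ k → p (transpose i j k))

-- G = δ_{i,j} F, i.e. G is the quotient (F - F|_{x_i↔x_j}) / (x_i - x_j)
-- in the power series ring (the quotient is unique since x_i - x_j is
-- a non-zero-divisor in ℤ[[x]]).
IsDivDiff : ∀ {m} → Fin m → Fin m → Series m → Series m → Set
IsDivDiff i j F G = ∀ p → mulVar i G p - mulVar j G p ≡ F p - swapVars i j F p

doubleMat : ∀ {r n} → Matrix r n → Matrix r (n Data.Nat.+ n)
doubleMat {n = n} B i k = [ B i , B i ] (splitAt n k)

shiftRhs : ∀ {r n} → Matrix r n → (Fin r → ℤ) → (Fin r → ℤ)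
shiftRhs B c i = c i - ∑ (λ j → B i j)

extend : ∀ {n} → Series n → Series (n Data.Nat.+ n)
extend {n} F p =
  if does (all? (λ k → p (n ↑ʳ k) Data.Nat.≟ 0))
  then F (λ k → p (k ↑ˡ n)) else 0ℤ

-- δ_{1,n+1} δ_{2,n+2} ⋯ δ_{n,2n} F = H  (δ_{n,2n} applied first):
-- there is a chain G_n = F, G_{k} = δ_{k+1,n+k+1} G_{k+1}, G_0 = H
-- (0-indexed: step k : Fin n uses variables k and n + k).
DivDiffChain : ∀ n → Series (n Data.Nat.+ n) → Series (n Data.Nat.+ n) → Set
DivDiffChain n F H =
  Data.Product.Σ (Fin (suc n) → Series (n Data.Nat.+ n)) λ G →
    (G (fromℕ n) ≋ F)
    Data.Product.× ((k : Fin n) → IsDivDiff (k ↑ˡ n) (n ↑ʳ k) (G (suc k)) (G (inject₁ k)))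
    Data.Product.× (G zero ≋ H)
  where import Data.Product

module Submission where

-- The one real computation
-- is the divided difference of a pure power:
--   δ_{i,j} x_i^v = Σ_{a+b+1=v} x_i^a x_j^b,
-- and more generally, if Φ_v(x) is free of x_i and x_j, then
--   δ_{i,j} Σ_v Φ_v x_i^v = Σ_{a,b} Φ_{a+b+1} x_i^a x_j^b       (divDiff-power).
-- The chain of divided differences is then made explicit by stages: at
-- stage m the columns j < m are still pending (x_{n+j} absent, x_j carries
-- the exponent of F's j-th variable), while every column j ≥ m is merged
-- (x_j^a x_{n+j}^b stands for the exponent a + b + 1).  Stage n is F itself,
-- passing from stage toℕ k + 1 to stage toℕ k is an instance of
-- divDiff-power for the pair (k, n + k), and stage 0 is the generating
-- function of the doubled system, because B(a + b + 1) = c holds exactly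
-- when [B | B](a, b) = c - B·1.

open import Defs
open import Data.Nat using (ℕ; zero; suc; pred; _<_; _<?_)
import Data.Nat as ℕ
import Data.Nat.Properties as ℕP
open import Data.Integer using (ℤ; +_; _+_; _-_; _*_; 0ℤ; 1ℤ)
import Data.Integer.Properties as ℤP
open import Data.Integer.Tactic.RingSolver using (solve-∀)
open import Data.Fin using (Fin; zero; suc; _↑ˡ_; _↑ʳ_; splitAt; inject₁; fromℕ; toℕ)
open import Data.Fin.Properties
  using (all?; _≟_; toℕ-injective; ↑ˡ-injective; ↑ʳ-injective; splitAt-↑ˡ; splitAt-↑ʳ;
         toℕ<n; toℕ-fromℕ; toℕ-inject₁)
open import Data.Fin.Permutation.Components using (transpose)
open import Data.Vec.Functional using (updateAt)
open import Data.Vec.Functional.Properties using (updateAt-updates; updateAt-minimal; updateAt-id-local)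
open import Data.Sum using ([_,_]; inj₁; inj₂)
open import Data.Product using (_,_)
open import Data.Bool using (Bool; if_then_else_)
open import Function using (_∘_; const; mk⇔)
open import Relation.Nullary using (Dec; yes; no; does; ¬_; contradiction)
open import Relation.Nullary.Decidable using (_→-dec_; dec-true; dec-false; does-⇔)
open import Relation.Binary.PropositionalEquality hiding ([_])
open ≡-Reasoning

∑-cong : ∀ {n} {f g : Fin n → ℤ} → (∀ j → f j ≡ g j) → ∑ f ≡ ∑ g
∑-cong {zero}  eq = refl
∑-cong {suc n} eq = cong₂ _+_ (eq zero) (∑-cong (eq ∘ suc))

∑-+ : ∀ {n} (f g : Fin n → ℤ) → ∑ (λ j → f j + g j) ≡ ∑ f + ∑ g
∑-+ {zero}  f g = refl
∑-+ {suc n} f g = begin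
  (f zero + g zero) + ∑ (λ j → f (suc j) + g (suc j))
    ≡⟨ cong (λ s → (f zero + g zero) + s) (∑-+ (f ∘ suc) (g ∘ suc)) ⟩
  (f zero + g zero) + (∑ (f ∘ suc) + ∑ (g ∘ suc))
    ≡⟨ interchange (f zero) (g zero) (∑ (f ∘ suc)) (∑ (g ∘ suc)) ⟩
  (f zero + ∑ (f ∘ suc)) + (g zero + ∑ (g ∘ suc)) ∎
  where
  interchange : ∀ a b c d → (a + b) + (c + d) ≡ (a + c) + (b + d)
  interchange = solve-∀

∑-split : ∀ m n (f : Fin (m ℕ.+ n) → ℤ) →
  ∑ f ≡ ∑ (λ i → f (i ↑ˡ n)) + ∑ (λ j → f (m ↑ʳ j))
∑-split zero    n f = sym (ℤP.+-identityˡ _)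
∑-split (suc m) n f =
  trans (cong (λ s → f zero + s) (∑-split m n (f ∘ suc))) (sym (ℤP.+-assoc (f zero) _ _))

transpose-left : ∀ {m} (i j : Fin m) → transpose i j i ≡ j
transpose-left i j rewrite dec-true (i ≟ i) refl = refl

transpose-right : ∀ {m} (i j : Fin m) → transpose i j j ≡ i
transpose-right i j with j ≟ i
... | yes j≡i = j≡i
... | no  _   rewrite dec-true (j ≟ j) refl = refl

transpose-other : ∀ {m} (i j k : Fin m) → k ≢ i → k ≢ j → transpose i j k ≡ k
transpose-other i j k k≢i k≢j rewrite dec-false (k ≟ i) k≢i | dec-false (k ≟ j) k≢j = refl

when : Bool → ℤ → ℤ
when b x = if b then x else 0ℤ

genFun-cong : ∀ {r n} (B : Matrix r n) (c : Fin r → ℤ) {u v : Mon n} →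
  (∀ j → u j ≡ v j) → genFun B c u ≡ genFun B c v
genFun-cong B c {u} {v} u≗v =
  cong (λ b → when b 1ℤ) (does-⇔ (mk⇔ (λ sol i → trans (sym (row i)) (sol i))
                                      (λ sol i → trans (row i) (sol i))) (all? _) (all? _))
  where
  row : ∀ i → ∑ (λ j → B i j * + u j) ≡ ∑ (λ j → B i j * + v j)
  row i = ∑-cong (λ j → cong (λ z → B i j * + z) (u≗v j))

mulVar-cong : ∀ {m} (i : Fin m) {G G' : Series m} → G ≋ G' → ∀ p → mulVar i G p ≡ mulVar i G' p
mulVar-cong i G≋G' p with p i
... | zero  = refl
... | suc _ = G≋G' _

IsDivDiff-cong : ∀ {m} {i j : Fin m} {F F' G G' : Series m} →
  F ≋ F' → G ≋ G' → IsDivDiff i j F G → IsDivDiff i j F' G'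
IsDivDiff-cong {i = i} {j} {F} {F'} {G} {G'} F≋F' G≋G' δ p = begin
  mulVar i G' p - mulVar j G' p
    ≡⟨ sym (cong₂ _-_ (mulVar-cong i G≋G' p) (mulVar-cong j G≋G' p)) ⟩
  mulVar i G p - mulVar j G p    ≡⟨ δ p ⟩
  F p - swapVars i j F p         ≡⟨ cong₂ _-_ (F≋F' p) (F≋F' _) ⟩
  F' p - swapVars i j F' p       ∎

-- lower a g is the value of g at a - 1, and 0 when a = 0: the coefficient
-- of x^a in x·Σ_a g(a) x^a.
lower : ℕ → (ℕ → ℤ) → ℤ
lower zero    g = 0ℤ
lower (suc a) g = g a

-- atZero b x is x when b = 0 and 0 otherwise: the coefficient of y^b in x.
atZero : ℕ → ℤ → ℤ
atZero zero    x = x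
atZero (suc _) x = 0ℤ

lower-cong : ∀ a {g h : ℕ → ℤ} → (∀ a' → a ≡ suc a' → g a' ≡ h a') →
  lower a g ≡ lower a h
lower-cong zero    eq = refl
lower-cong (suc a) eq = eq a refl

mulVar-lower : ∀ {m} (i : Fin m) (G : Series m) p →
  mulVar i G p ≡ lower (p i) (λ _ → G (updateAt p i pred))
mulVar-lower i G p with p i
... | zero  = refl
... | suc _ = refl

-- The two-variable identity (x - y) Σ_{a+b+1=v} x^a y^b = x^v - y^v,
-- read off at the coefficient of x^a y^b for the series Σ_v f(v) x^v.
twoVariableDivDiff : (f : ℕ → ℤ) (a b : ℕ) →
  lower a (λ a' → f (suc (a' ℕ.+ b))) - lower b (λ b' → f (suc (a ℕ.+ b')))
    ≡ atZero b (f a) - atZero a (f b)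
twoVariableDivDiff f zero    zero    = sym (ℤP.+-inverseʳ (f zero))
twoVariableDivDiff f (suc a) zero    = cong (λ e → f (suc e) - 0ℤ) (ℕP.+-identityʳ a)
twoVariableDivDiff f zero    (suc b) = refl
twoVariableDivDiff f (suc a) (suc b) = begin
  f (suc (a ℕ.+ suc b)) - f v  ≡⟨ cong (λ e → f (suc e) - f v) (ℕP.+-suc a b) ⟩
  f v - f v                    ≡⟨ ℤP.+-inverseʳ (f v) ⟩
  0ℤ - 0ℤ                      ∎
  where
  v = suc (suc (a ℕ.+ b))

FreeOf : ∀ {m} → Fin m → Fin m → (Mon m → ℕ → ℤ) → Set
FreeOf i j Φ = ∀ p p' → (∀ x → x ≢ i → x ≢ j → p x ≡ p' x) → ∀ v → Φ p v ≡ Φ p' v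

-- Σ_v Φ_v x_i^v, for Φ free of x_i and x_j.
powerSeries : ∀ {m} → Fin m → Fin m → (Mon m → ℕ → ℤ) → Series m
powerSeries i j Φ p = atZero (p j) (Φ p (p i))

-- Σ_{a,b} Φ_{a+b+1} x_i^a x_j^b.
dividedPowerSeries : ∀ {m} → Fin m → Fin m → (Mon m → ℕ → ℤ) → Series m
dividedPowerSeries i j Φ p = Φ p (suc (p i ℕ.+ p j))

divDiff-power : ∀ {m} {i j : Fin m} {Φ : Mon m → ℕ → ℤ} → i ≢ j → FreeOf i j Φ →
  IsDivDiff i j (powerSeries i j Φ) (dividedPowerSeries i j Φ)
divDiff-power {i = i} {j} {Φ} i≢j free p = begin
  mulVar i Q p - mulVar j Q p
    ≡⟨ cong₂ _-_ (trans (mulVar-lower i Q p) (lower-cong (p i) lowerᵢ))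
                 (trans (mulVar-lower j Q p) (lower-cong (p j) lowerⱼ)) ⟩
  lower (p i) (λ a → Φ p (suc (a ℕ.+ p j))) - lower (p j) (λ b → Φ p (suc (p i ℕ.+ b)))
    ≡⟨ twoVariableDivDiff (Φ p) (p i) (p j) ⟩
  atZero (p j) (Φ p (p i)) - atZero (p i) (Φ p (p j))
    ≡⟨ cong (λ e → N p - atZero e (Φ p (p j))) (cong p (sym (transpose-right i j))) ⟩
  N p - atZero (swapped j) (Φ p (p j))
    ≡⟨ cong (λ e → N p - atZero (swapped j) e)
            (trans (free p swapped (λ x x≢i x≢j → cong p (sym (transpose-other i j x x≢i x≢j))) (p j))
                   (cong (Φ swapped) (cong p (sym (transpose-left i j))))) ⟩
  N p - swapVars i j N p ∎
  where
  Q N : Series _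
  Q = dividedPowerSeries i j Φ
  N = powerSeries i j Φ
  swapped : Mon _
  swapped x = p (transpose i j x)
  lowerᵢ : ∀ a → p i ≡ suc a → Q (updateAt p i pred) ≡ Φ p (suc (a ℕ.+ p j))
  lowerᵢ a eq = trans (free _ p (λ x x≢i _ → updateAt-minimal x i p x≢i) _)
    (cong₂ (λ u w → Φ p (suc (u ℕ.+ w)))
      (trans (updateAt-updates i p) (cong pred eq)) (updateAt-minimal j i p (i≢j ∘ sym)))
  lowerⱼ : ∀ b → p j ≡ suc b → Q (updateAt p j pred) ≡ Φ p (suc (p i ℕ.+ b))
  lowerⱼ b eq = trans (free _ p (λ x _ x≢j → updateAt-minimal x j p x≢j) _)
    (cong₂ (λ u w → Φ p (suc (u ℕ.+ w)))
      (updateAt-minimal i j p i≢j) (trans (updateAt-updates j p) (cong pred eq)))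

module Stages {r n : ℕ} (B : Matrix r n) (c : Fin r → ℤ) where

  L R : Fin n → Fin (n ℕ.+ n)
  L j = j ↑ˡ n
  R j = n ↑ʳ j

  L≢R : ∀ j j' → L j ≢ R j'
  L≢R j j' eq with trans (sym (splitAt-↑ˡ n j n)) (trans (cong (splitAt n) eq) (splitAt-↑ʳ n n j'))
  ... | ()

  PendingFree : ℕ → Mon (n ℕ.+ n) → Set
  PendingFree m p = ∀ j → toℕ j < m → p (R j) ≡ 0

  pendingFree? : ∀ m p → Dec (PendingFree m p)
  pendingFree? m p = all? (λ j → (toℕ j <? m) →-dec (p (R j) ℕ.≟ 0))

  -- The exponent vector of F that x^p stands for at stage m.
  merged : ℕ → Mon (n ℕ.+ n) → Mon n
  merged m p j with toℕ j <? m
  ... | yes _ = p (L j)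
  ... | no  _ = suc (p (L j) ℕ.+ p (R j))

  -- The series reached after the divided differences δ_{j,n+j}, j ≥ m.
  stage : ℕ → Series (n ℕ.+ n)
  stage m p = when (does (pendingFree? m p)) (genFun B c (merged m p))

  merged-pending : ∀ m p j → toℕ j < m → merged m p j ≡ p (L j)
  merged-pending m p j j<m with toℕ j <? m
  ... | yes _   = refl
  ... | no  j≮m = contradiction j<m j≮m

  merged-done : ∀ m p j → ¬ toℕ j < m → merged m p j ≡ suc (p (L j) ℕ.+ p (R j))
  merged-done m p j j≮m with toℕ j <? m
  ... | yes j<m = contradiction j<m j≮m
  ... | no  _   = refl

  merged-cong : ∀ m {p p'} j → p (L j) ≡ p' (L j) → p (R j) ≡ p' (R j) →
    merged m p j ≡ merged m p' j
  merged-cong m j eqL eqR with toℕ j <? m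
  ... | yes _ = eqL
  ... | no  _ = cong₂ (λ a b → suc (a ℕ.+ b)) eqL eqR

  stage-top : stage n ≋ extend (genFun B c)
  stage-top p = cong₂ when
    (does-⇔ (mk⇔ (λ free j → free j (toℕ<n j)) (λ free j _ → free j)) (pendingFree? n p) (all? _))
    (genFun-cong B c (λ j → merged-pending n p j (toℕ<n j)))

  row-doubled : ∀ (p : Mon (n ℕ.+ n)) i → ∑ (λ k → doubleMat B i k * + p k)
                          ≡ ∑ (λ j → B i j * + p (L j)) + ∑ (λ j → B i j * + p (R j))
  row-doubled p i = trans (∑-split n n (λ k → doubleMat B i k * + p k)) (cong₂ _+_
    (∑-cong (λ j → cong (λ b → [ B i , B i ] b * + p (L j)) (splitAt-↑ˡ n j n)))
    (∑-cong (λ j → cong (λ b → [ B i , B i ] b * + p (R j)) (splitAt-↑ʳ n n j))))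

  row-merged : ∀ (p : Mon (n ℕ.+ n)) i →
    ∑ (λ j → B i j * + merged 0 p j) ≡ ∑ (λ k → doubleMat B i k * + p k) + ∑ (B i)
  row-merged p i = begin
    ∑ (λ j → B i j * + merged 0 p j)
      ≡⟨ ∑-cong (λ j → cong (λ e → B i j * + e) (merged-done 0 p j λ ())) ⟩
    ∑ (λ j → B i j * + suc (p (L j) ℕ.+ p (R j)))
      ≡⟨ ∑-cong (λ j → expand (B i j) (p (L j)) (p (R j))) ⟩
    ∑ (λ j → (B i j * + p (L j) + B i j * + p (R j)) + B i j)
      ≡⟨ trans (∑-+ (λ j → B i j * + p (L j) + B i j * + p (R j)) (B i))
               (cong (_+ ∑ (B i)) (∑-+ (λ j → B i j * + p (L j)) (λ j → B i j * + p (R j)))) ⟩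
    ∑ (λ j → B i j * + p (L j)) + ∑ (λ j → B i j * + p (R j)) + ∑ (B i)
      ≡⟨ cong (_+ ∑ (B i)) (sym (row-doubled p i)) ⟩
    ∑ (λ k → doubleMat B i k * + p k) + ∑ (B i) ∎
    where
    distrib : ∀ z x y → z * (1ℤ + (x + y)) ≡ (z * x + z * y) + z
    distrib = solve-∀
    expand : ∀ z a b → z * + suc (a ℕ.+ b) ≡ (z * + a + z * + b) + z
    expand z a b = trans
      (cong (z *_) (trans (ℤP.pos-+ 1 (a ℕ.+ b)) (cong (λ s → 1ℤ + s) (ℤP.pos-+ a b))))
      (distrib z (+ a) (+ b))

  stage-bottom : stage 0 ≋ genFun (doubleMat B) (shiftRhs B c)
  stage-bottom p = begin
    when (does (pendingFree? 0 p)) (genFun B c (merged 0 p))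
      ≡⟨ cong (λ b → when b (genFun B c (merged 0 p))) (dec-true (pendingFree? 0 p) (λ _ ())) ⟩
    genFun B c (merged 0 p)
      ≡⟨ cong (λ b → when b 1ℤ) (does-⇔ (mk⇔ to from) (all? _) (all? _)) ⟩
    genFun (doubleMat B) (shiftRhs B c) p ∎
    where
    cancel : ∀ x s → x ≡ (x + s) - s
    cancel = solve-∀
    uncancel : ∀ x s → (x - s) + s ≡ x
    uncancel = solve-∀
    to : (∀ i → ∑ (λ j → B i j * + merged 0 p j) ≡ c i) →
         ∀ i → ∑ (λ k → doubleMat B i k * + p k) ≡ shiftRhs B c i
    to sol i = trans (cancel _ (∑ (B i))) (cong (_- ∑ (B i)) (trans (sym (row-merged p i)) (sol i)))
    from : (∀ i → ∑ (λ k → doubleMat B i k * + p k) ≡ shiftRhs B c i) →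
           ∀ i → ∑ (λ j → B i j * + merged 0 p j) ≡ c i
    from sol i = trans (row-merged p i) (trans (cong (_+ ∑ (B i)) (sol i)) (uncancel (c i) (∑ (B i))))

  module Step (k : Fin n) where

    m : ℕ
    m = toℕ k

    -- Both stages, as series in x_k with coefficients free of x_k, x_{n+k}.
    Φ : Mon (n ℕ.+ n) → ℕ → ℤ
    Φ p v = when (does (pendingFree? m p)) (genFun B c (updateAt (merged m p) k (const v)))

    Φ-free : FreeOf (L k) (R k) Φ
    Φ-free p p' agree v = cong₂ when
      (does-⇔ (mk⇔ (λ free j j<m → trans (sym (sameR j (pending≢k j<m))) (free j j<m))
                   (λ free j j<m → trans (sameR j (pending≢k j<m)) (free j j<m)))
              (pendingFree? m p) (pendingFree? m p'))
      (genFun-cong B c sameEntry)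
      where
      pending≢k : ∀ {j} → toℕ j < m → j ≢ k
      pending≢k j<m refl = ℕP.<-irrefl refl j<m
      sameL : ∀ j → j ≢ k → p (L j) ≡ p' (L j)
      sameL j j≢k = agree (L j) (j≢k ∘ ↑ˡ-injective n j k) (L≢R j k)
      sameR : ∀ j → j ≢ k → p (R j) ≡ p' (R j)
      sameR j j≢k = agree (R j) (L≢R k j ∘ sym) (j≢k ∘ ↑ʳ-injective n j k)
      sameEntry : ∀ j → updateAt (merged m p) k (const v) j ≡ updateAt (merged m p') k (const v) j
      sameEntry j with j ≟ k
      ... | yes refl = trans (updateAt-updates k (merged m p)) (sym (updateAt-updates k (merged m p')))
      ... | no  j≢k  = trans (updateAt-minimal j k (merged m p) j≢k)
        (trans (merged-cong m j (sameL j j≢k) (sameR j j≢k)) (sym (updateAt-minimal j k (merged m p') j≢k)))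

    -- At stage m, column k is merged: x_k^a x_{n+k}^b stands for exponent a + b + 1.
    stage-divided : stage m ≋ dividedPowerSeries (L k) (R k) Φ
    stage-divided p = cong (when (does (pendingFree? m p))) (genFun-cong B c (λ j →
      sym (updateAt-id-local k (merged m p) (sym (merged-done m p k (ℕP.<-irrefl refl))) j)))

    merged-step : ∀ p j → j ≢ k → merged (suc m) p j ≡ merged m p j
    merged-step p j j≢k with toℕ j <? m
    ... | yes j<m = merged-pending (suc m) p j (ℕP.m<n⇒m<1+n j<m)
    ... | no  j≮m = merged-done (suc m) p j ([ j≮m , j≢k ∘ toℕ-injective ] ∘ ℕP.m<1+n⇒m<n∨m≡n)

    -- At stage m + 1, column k is pending: x_{n+k} is absent, x_k carries its exponent.
    stage-power : stage (suc m) ≋ powerSeries (L k) (R k) Φ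
    stage-power p with p (R k) in eqR
    ... | suc _ = cong (λ b → when b (genFun B c (merged (suc m) p)))
          (dec-false (pendingFree? (suc m) p) (λ free → case (trans (sym eqR) (free k (ℕP.n<1+n m)))))
      where
      case : ∀ {a} → suc a ≢ 0
      case ()
    ... | zero  = cong₂ when
          (does-⇔ (mk⇔ (λ free j j<m → free j (ℕP.m<n⇒m<1+n j<m)) extend-free)
                  (pendingFree? (suc m) p) (pendingFree? m p))
          (genFun-cong B c entry)
      where
      extend-free : PendingFree m p → PendingFree (suc m) p
      extend-free free j j<1+m with ℕP.m<1+n⇒m<n∨m≡n j<1+m
      ... | inj₁ j<m = free j j<m
      ... | inj₂ j≡m rewrite toℕ-injective {i = j} {j = k} j≡m = eqR
      entry : ∀ j → merged (suc m) p j ≡ updateAt (merged m p) k (const (p (L k))) j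
      entry j with j ≟ k
      ... | yes refl = trans (merged-pending (suc m) p k (ℕP.n<1+n m))
                             (sym (updateAt-updates k (merged m p)))
      ... | no  j≢k  = trans (merged-step p j j≢k) (sym (updateAt-minimal j k (merged m p) j≢k))

    stage-step : IsDivDiff (L k) (R k) (stage (suc m)) (stage m)
    stage-step = IsDivDiff-cong (sym ∘ stage-power) (sym ∘ stage-divided)
                   (divDiff-power (L≢R k k) Φ-free)

theorem4p1 : (r n : ℕ) (B : Matrix r n) (c : Fin r → ℤ) →
    DivDiffChain n (extend (genFun B c)) (genFun (doubleMat B) (shiftRhs B c))
theorem4p1 r n B c = stage ∘ toℕ , top , steps , stage-bottom
  where
  open Stages B c
  top : stage (toℕ (fromℕ n)) ≋ extend (genFun B c)
  top rewrite toℕ-fromℕ n = stage-top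
  steps : (k : Fin n) → IsDivDiff (L k) (R k) (stage (suc (toℕ k))) (stage (toℕ (inject₁ k)))
  steps k rewrite toℕ-inject₁ k = Step.stage-step k
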